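{- (a) If $\sigma\in I(321)_n$ with $n>2$ is a simple involution, then $n$ is even. (b) If $\sigma\in I(321)_n$ with $n>2$ is a simple involution and $\pi=\sigma[\alpha_1,\dots,\alpha_n]$ is an involution (for some nonempty permutations $\alpha_1,\dots,\alpha_n$), then the length of $\pi$ is even.
   Context: A permutation of length $n$ is a bijection of $\{1,\dots,n\}$ in one-line notation. A permutation avoids $321$ if it has no indices $i<j<k$ with $\pi(i)>\pi(j)>\pi(k)$. An involution satisfies $\pi(\pi(i))=i$ for all $i$. $I(321)_n$ is the set of involutions of length $n$ avoiding $321$. An interval of a permutation of length $n$ is a set of contiguous positions whose image is a set of contiguous integers; a permutation is simple if its only intervals are the empty set, singletons and $[1,n]$. For $\sigma$ of length $k$ and nonempty permutations $\alpha_1,\dots,\alpha_k$, the inflation $\sigma[\alpha_1,\dots,\alpha_k]$ replaces each entry $\sigma(i)$ by a block of consecutive positions order-isomorphic to $\alpha_i$, with the blocks' value sets being intervals of integers ordered relative to each other as $\sigma(1),\dots,\sigma(k)$. -}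

module Defs where

open import Data.Nat using (ℕ; zero; suc; _+_; _∸_; _≤_; _<_)
open import Data.Fin using (Fin; toℕ) renaming (zero to fzero; suc to fsuc)
open import Data.Fin.Permutation using (Permutation′; _⟨$⟩ʳ_; _⟨$⟩ˡ_)
open import Data.Product using (Σ; ∃; _×_)
open import Data.Sum using (_⊎_)
open import Relation.Binary.PropositionalEquality using (_≡_)
open import Relation.Nullary using (¬_)

-- A permutation of length n (one-line notation i ↦ π(i), positions/values 0..n-1).
Perm : ℕ → Set
Perm n = Permutation′ n

IsInvolution : ∀ {n} → Perm n → Set
IsInvolution {n} π = ∀ (i : Fin n) → π ⟨$⟩ʳ (π ⟨$⟩ʳ i) ≡ i

Avoids321 : ∀ {n} → Perm n → Set
Avoids321 {n} π = ∀ (i j k : Fin n) → toℕ i < toℕ j → toℕ j < toℕ k →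
  ¬ (toℕ (π ⟨$⟩ʳ k) < toℕ (π ⟨$⟩ʳ j) × toℕ (π ⟨$⟩ʳ j) < toℕ (π ⟨$⟩ʳ i))

InI321 : ∀ {n} → Perm n → Set
InI321 π = IsInvolution π × Avoids321 π

IsInterval : ∀ {n} → Perm n → Fin n → Fin n → Set
IsInterval {n} π a b =
  Σ ℕ λ c → ∀ (v : ℕ) →
    ((c ≤ v × v ≤ c + (toℕ b ∸ toℕ a)) →
       ∃ λ (i : Fin n) → toℕ a ≤ toℕ i × toℕ i ≤ toℕ b × toℕ (π ⟨$⟩ʳ i) ≡ v)
    × ((∃ λ (i : Fin n) → toℕ a ≤ toℕ i × toℕ i ≤ toℕ b × toℕ (π ⟨$⟩ʳ i) ≡ v) →
       c ≤ v × v ≤ c + (toℕ b ∸ toℕ a))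

IsSimple : ∀ {n} → Perm n → Set
IsSimple {n} π = ∀ (a b : Fin n) → toℕ a ≤ toℕ b → IsInterval π a b →
  a ≡ b ⊎ (toℕ a ≡ 0 × suc (toℕ b) ≡ n)

sumLt : ∀ {k} → (Fin k → ℕ) → ℕ → ℕ
sumLt {zero}  f b       = 0
sumLt {suc k} f zero    = 0
sumLt {suc k} f (suc b) = f fzero + sumLt (λ u → f (fsuc u)) b

sumAll : ∀ {k} → (Fin k → ℕ) → ℕ
sumAll {k} f = sumLt f k

-- π = σ[α_1,…,α_k], where block i has size m i and pattern α i.
-- Block i occupies positions start(i) … start(i)+m(i)-1 with start(i) = Σ_{u<i} m u,
-- and its values are vstart(σ i) + α_i(j), where the value-blocks are ordered as
-- σ orders them: vstart(v) = Σ_{w<v} m(σ⁻¹ w).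
IsInflation : ∀ {k} (σ : Perm k) (m : Fin k → ℕ) (α : (i : Fin k) → Perm (m i))
  → Perm (sumAll m) → Set
IsInflation {k} σ m α π =
  ∀ (i : Fin k) (j : Fin (m i)) (p : Fin (sumAll m)) →
    toℕ p ≡ sumLt m (toℕ i) + toℕ j →
    toℕ (π ⟨$⟩ʳ p) ≡ sumLt (λ w → m (σ ⟨$⟩ˡ w)) (toℕ (σ ⟨$⟩ʳ i)) + toℕ (α i ⟨$⟩ʳ j)

-- Both parts reduce to one counting fact: a fixed-point-free involution of {0,…,N-1} has N
-- even (involution-even, proved by counting the pairs inside each prefix).
-- (a) σ has no fixed point (no-fixed-point): around a fixed point p, 321-avoidance keeps
--     σ on each side of p, which produces a proper σ-closed range, i.e. a nontrivial interval.
-- (b) The positions of π split into blocks of sizes m u, its values into blocks of sizes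
--     m (σ⁻¹ w), and π exchanges position block u with value block σ u.  Scanning from the
--     left, a first block of different size would make some run of blocks [r, hi] an interval
--     of σ exchanged with another run (pigeonhole, exchanged-interval), forcing σ to swap the
--     first and last positions, which 321-avoidance forbids (Correspondence.not-shorter).
--     So both block systems coincide, a fixed point of π would give one of σ, and (a)'s
--     fact applies to π.
module Submission where

open import Defs
open import Data.Nat using (ℕ; _<_; _≤_)
open import Data.Nat.Divisibility using (_∣_)
open import Data.Fin using (Fin)
open import Data.Product using (_×_)

open import Data.Nat using (zero; suc; pred; _+_; _*_; _∸_; z≤n; s≤s; s≤s⁻¹; _<?_; _≟_)
open import Data.Nat.Properties
open import Data.Nat.Divisibility using (∣m∣n⇒∣m+n; m∣m*n; _∣0)
open import Algebra.Properties.CommutativeSemigroup +-commutativeSemigroup using (interchange; x∙yz≈y∙xz)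
open import Data.Fin using (toℕ; fromℕ<) renaming (zero to fzero; suc to fsuc)
open import Data.Fin.Properties using (toℕ<n; toℕ-fromℕ<; fromℕ<-toℕ; toℕ-injective; injective⇒≤)
open import Data.Fin.Permutation using (_⟨$⟩ʳ_; _⟨$⟩ˡ_; inverseˡ; flip)
open import Algebra.Properties.CommutativeMonoid.Sum +-0-commutativeMonoid using (sum; sum-permute)
open import Data.Product using (∃; _,_; proj₁; proj₂)
open import Data.Sum using (inj₁; inj₂)
open import Relation.Binary.PropositionalEquality
open import Relation.Nullary using (¬_; Dec; yes; no)
open import Data.Empty using (⊥; ⊥-elim)
open import Relation.Binary.Definitions using (tri<; tri≈; tri>)

ind : {P : Set} → Dec P → ℕ
ind (yes _) = 1
ind (no _)  = 0

ind-yes : {P : Set} (d : Dec P) → P → ind d ≡ 1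
ind-yes (yes _) _ = refl
ind-yes (no ¬p) p = ⊥-elim (¬p p)

ind-no : {P : Set} (d : Dec P) → ¬ P → ind d ≡ 0
ind-no (yes p) ¬p = ⊥-elim (¬p p)
ind-no (no _)  _  = refl

ind-cong : {P Q : Set} → (P → Q) → (Q → P) → (p : Dec P) (q : Dec Q) → ind p ≡ ind q
ind-cong to from (yes p) q = sym (ind-yes q (to p))
ind-cong to from (no ¬p) q = sym (ind-no q (λ z → ¬p (from z)))

ind-<-suc : ∀ x j → ind (x <? suc j) ≡ ind (x ≟ j) + ind (x <? j)
ind-<-suc x j with <-cmp x j
... | tri< x<j x≢j _ rewrite ind-yes (x <? suc j) (m<n⇒m<1+n x<j) | ind-no (x ≟ j) x≢j
                           | ind-yes (x <? j) x<j = refl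
... | tri≈ _ refl _ rewrite ind-yes (x <? suc x) (n<1+n x) | ind-yes (x ≟ x) refl
                          | ind-no (x <? x) (n≮n x) = refl
... | tri> _ x≢j j<x rewrite ind-no (x <? suc j) (λ x<1+j → <⇒≱ j<x (s≤s⁻¹ x<1+j))
                           | ind-no (x ≟ j) x≢j | ind-no (x <? j) (<⇒≯ j<x) = refl

count : {P : ℕ → Set} → (∀ i → Dec (P i)) → ℕ → ℕ
count P? zero    = 0
count P? (suc j) = ind (P? j) + count P? j

count-additive : {P Q R : ℕ → Set} (P? : ∀ i → Dec (P i)) (Q? : ∀ i → Dec (Q i)) (R? : ∀ i → Dec (R i)) →
  (∀ i → ind (R? i) ≡ ind (P? i) + ind (Q? i)) → ∀ j → count R? j ≡ count P? j + count Q? j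
count-additive P? Q? R? split zero    = refl
count-additive P? Q? R? split (suc j) = begin
  ind (R? j) + count R? j                               ≡⟨ cong₂ _+_ (split j) (count-additive P? Q? R? split j) ⟩
  (ind (P? j) + ind (Q? j)) + (count P? j + count Q? j) ≡⟨ interchange (ind (P? j)) (ind (Q? j)) _ _ ⟩
  (ind (P? j) + count P? j) + (ind (Q? j) + count Q? j) ∎
  where open ≡-Reasoning

count-all : {P : ℕ → Set} (P? : ∀ i → Dec (P i)) → ∀ j → (∀ i → i < j → P i) → count P? j ≡ j
count-all P? zero    _   = refl
count-all P? (suc j) all = cong₂ _+_ (ind-yes (P? j) (all j (n<1+n j)))
                                     (count-all P? j (λ i i<j → all i (m<n⇒m<1+n i<j)))

-- Writing
-- c k = #{i < k ∣ F i < k}, the only possible preimage of k below k is F k, so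
-- c (k+1) = c k + 2·[F k < k]; hence every c k is even, and c N = N.
module FixedPointFreeInvolution (F : ℕ → ℕ) (N : ℕ)
  (F<N : ∀ i → i < N → F i < N)
  (involutive : ∀ i → i < N → F (F i) ≡ i)
  (no-fixed : ∀ i → i < N → F i ≢ i) where

  -- #{ i < j ∣ F i = k } = [F k < j]: the only preimage of k is F k.
  preimages : ∀ k j → k < N → j ≤ N → count (λ i → F i ≟ k) j ≡ ind (F k <? j)
  preimages k zero    k<N _   = sym (ind-no (F k <? 0) λ ())
  preimages k (suc j) k<N j<N = begin
    ind (F j ≟ k) + count (λ i → F i ≟ k) j ≡⟨ cong₂ _+_ (ind-cong to from _ _) (preimages k j k<N (<⇒≤ j<N)) ⟩
    ind (F k ≟ j) + ind (F k <? j)         ≡⟨ sym (ind-<-suc (F k) j) ⟩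
    ind (F k <? suc j)                     ∎
    where
    open ≡-Reasoning
    to : F j ≡ k → F k ≡ j
    to refl = involutive j j<N
    from : F k ≡ j → F j ≡ k
    from refl = involutive k k<N

  -- inside k = #{ i < k ∣ F i < k }, twice the number of 2-cycles of F inside [0,k)
  inside : ℕ → ℕ
  inside k = count (λ i → F i <? k) k

  inside-suc : ∀ k → k < N → inside (suc k) ≡ inside k + 2 * ind (F k <? k)
  inside-suc k k<N = begin
    ind (F k <? suc k) + count (λ i → F i <? suc k) k
      ≡⟨ cong₂ _+_ (ind-<-suc (F k) k) (count-additive (λ i → F i <? k) (λ i → F i ≟ k) (λ i → F i <? suc k) split k) ⟩
    (ind (F k ≟ k) + t) + (inside k + count (λ i → F i ≟ k) k)
      ≡⟨ cong₂ (λ a b → (a + t) + (inside k + b)) (ind-no (F k ≟ k) (no-fixed k k<N)) (preimages k k k<N (<⇒≤ k<N)) ⟩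
    t + (inside k + t)
      ≡⟨ x∙yz≈y∙xz t (inside k) t ⟩
    inside k + (t + t)
      ≡⟨ cong (λ z → inside k + (t + z)) (sym (+-identityʳ t)) ⟩
    inside k + 2 * t ∎
    where
    open ≡-Reasoning
    t : ℕ
    t = ind (F k <? k)
    split : ∀ i → ind (F i <? suc k) ≡ ind (F i <? k) + ind (F i ≟ k)
    split i = trans (ind-<-suc (F i) k) (+-comm (ind (F i ≟ k)) (ind (F i <? k)))

  inside-even : ∀ k → k ≤ N → 2 ∣ inside k
  inside-even zero    _     = 2 ∣0
  inside-even (suc k) k<N   = subst (2 ∣_) (sym (inside-suc k k<N))
                               (∣m∣n⇒∣m+n (inside-even k (<⇒≤ k<N)) (m∣m*n (ind (F k <? k))))

  even : 2 ∣ N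
  even = subst (2 ∣_) (count-all (λ i → F i <? N) N F<N) (inside-even N ≤-refl)

-- To count along ℕ, a map on Fin N is extended by 0 outside [0,N).
extend : ∀ {N} → (Fin N → Fin N) → ℕ → ℕ
extend {N} f i with i <? N
... | yes i<N = toℕ (f (fromℕ< i<N))
... | no  _   = 0

extend-toℕ : ∀ {N} (f : Fin N → Fin N) (i : Fin N) → extend f (toℕ i) ≡ toℕ (f i)
extend-toℕ {N} f i with toℕ i <? N
... | yes i<N = cong (λ j → toℕ (f j)) (fromℕ<-toℕ i i<N)
... | no  i≮N = ⊥-elim (i≮N (toℕ<n i))

below-from-Fin : ∀ {N} (P : ℕ → Set) → (∀ (i : Fin N) → P (toℕ i)) → ∀ i → i < N → P i
below-from-Fin P all i i<N = subst P (toℕ-fromℕ< i<N) (all (fromℕ< i<N))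

extend-< : ∀ {N} (f : Fin N → Fin N) → ∀ i → i < N → extend f i < N
extend-< {N} f = below-from-Fin (λ i → extend f i < N)
  (λ i → subst (_< N) (sym (extend-toℕ f i)) (toℕ<n (f i)))

extend-involutive : ∀ {N} (f : Fin N → Fin N) → (∀ i → f (f i) ≡ i) →
  ∀ i → i < N → extend f (extend f i) ≡ i
extend-involutive f invol = below-from-Fin (λ i → extend f (extend f i) ≡ i) λ i → begin
  extend f (extend f (toℕ i)) ≡⟨ cong (extend f) (extend-toℕ f i) ⟩
  extend f (toℕ (f i))        ≡⟨ extend-toℕ f (f i) ⟩
  toℕ (f (f i))               ≡⟨ cong toℕ (invol i) ⟩
  toℕ i                       ∎
  where open ≡-Reasoning

involution-even : ∀ {N} (f : Fin N → Fin N) → (∀ i → f (f i) ≡ i) → (∀ i → f i ≢ i) → 2 ∣ N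
involution-even {N} f invol no-fixed =
  FixedPointFreeInvolution.even (extend f) N (extend-< f) (extend-involutive f invol)
    (below-from-Fin (λ i → extend f i ≢ i)
      λ i fixed → no-fixed i (toℕ-injective (trans (sym (extend-toℕ f i)) fixed)))

MapsInto : ∀ {n} → Perm n → ℕ → ℕ → ℕ → ℕ → Set
MapsInto {n} σ a b c d =
  ∀ (i : Fin n) → a ≤ toℕ i → toℕ i ≤ b → c ≤ toℕ (σ ⟨$⟩ʳ i) × toℕ (σ ⟨$⟩ʳ i) ≤ d

permutation-injective : ∀ {n} (σ : Perm n) {i j : Fin n} → σ ⟨$⟩ʳ i ≡ σ ⟨$⟩ʳ j → i ≡ j
permutation-injective σ e = trans (sym (inverseˡ σ)) (trans (cong (σ ⟨$⟩ˡ_) e) (inverseˡ σ))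

involution-swap : ∀ {n} (σ : Perm n) → IsInvolution σ → ∀ {i j} → σ ⟨$⟩ʳ i ≡ j → σ ⟨$⟩ʳ j ≡ i
involution-swap σ inv refl = inv _

range-length-≤ : ∀ {n} (σ : Perm n) {a b c d : ℕ} → a ≤ b → b < n → MapsInto σ a b c d → b ∸ a ≤ d ∸ c
range-length-≤ {n} σ {a} {b} {c} {d} a≤b b<n maps = s≤s⁻¹ (injective⇒≤ offset-injective)
  where
  in-range : ∀ (j : Fin (suc (b ∸ a))) → a + toℕ j ≤ b
  in-range j = subst (a + toℕ j ≤_) (m+[n∸m]≡n a≤b) (+-monoʳ-≤ a (s≤s⁻¹ (toℕ<n j)))
  position : Fin (suc (b ∸ a)) → Fin n
  position j = fromℕ< (≤-<-trans (in-range j) b<n)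
  image : Fin (suc (b ∸ a)) → ℕ
  image j = toℕ (σ ⟨$⟩ʳ position j)
  image-in-range : ∀ j → c ≤ image j × image j ≤ d
  image-in-range j = maps (position j) (subst (a ≤_) (sym at) (m≤m+n a (toℕ j))) (subst (_≤ b) (sym at) (in-range j))
    where
    at : toℕ (position j) ≡ a + toℕ j
    at = toℕ-fromℕ< (≤-<-trans (in-range j) b<n)
  offset : Fin (suc (b ∸ a)) → Fin (suc (d ∸ c))
  offset j = fromℕ< (s≤s (∸-monoˡ-≤ c (proj₂ (image-in-range j))))
  offset-injective : ∀ {i j} → offset i ≡ offset j → i ≡ j
  offset-injective {i} {j} e = toℕ-injective (+-cancelˡ-≡ a _ _ (begin
    a + toℕ i           ≡⟨ sym (toℕ-fromℕ< _) ⟩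
    toℕ (position i)    ≡⟨ cong toℕ (permutation-injective σ (toℕ-injective same-image)) ⟩
    toℕ (position j)    ≡⟨ toℕ-fromℕ< _ ⟩
    a + toℕ j           ∎))
    where
    open ≡-Reasoning
    same-image : image i ≡ image j
    same-image = ∸-cancelʳ-≡ (proj₁ (image-in-range i)) (proj₁ (image-in-range j))
                   (trans (sym (toℕ-fromℕ< _)) (trans (cong toℕ e) (toℕ-fromℕ< _)))

exchanged-interval : ∀ {n} (σ : Perm n) → IsInvolution σ → (a b : Fin n) {c d : ℕ} →
  toℕ a ≤ toℕ b → d < n → MapsInto σ (toℕ a) (toℕ b) c d → MapsInto σ c d (toℕ a) (toℕ b) →
  IsInterval σ a b
exchanged-interval {n} σ inv a b {c} {d} a≤b d<n forth back = c , λ v → hit v , land v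
  where
  c≤d : c ≤ d
  c≤d = ≤-trans (proj₁ (forth a ≤-refl a≤b)) (proj₂ (forth a ≤-refl a≤b))
  -- pigeonhole in both directions: the two ranges have the same length
  same-length : c + (toℕ b ∸ toℕ a) ≡ d
  same-length = trans (cong (c +_) (≤-antisym (range-length-≤ σ a≤b (toℕ<n b) forth)
                                               (range-length-≤ σ c≤d d<n back)))
                      (m+[n∸m]≡n c≤d)
  hit : ∀ v → c ≤ v × v ≤ c + (toℕ b ∸ toℕ a) →
        ∃ λ (i : Fin n) → toℕ a ≤ toℕ i × toℕ i ≤ toℕ b × toℕ (σ ⟨$⟩ʳ i) ≡ v
  hit v (c≤v , v≤end) = σ ⟨$⟩ʳ w , proj₁ bounds , proj₂ bounds , trans (cong toℕ (inv w)) at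
    where
    v≤d : v ≤ d
    v≤d = subst (v ≤_) same-length v≤end
    w : Fin n
    w = fromℕ< (≤-<-trans v≤d d<n)
    at : toℕ w ≡ v
    at = toℕ-fromℕ< (≤-<-trans v≤d d<n)
    bounds : toℕ a ≤ toℕ (σ ⟨$⟩ʳ w) × toℕ (σ ⟨$⟩ʳ w) ≤ toℕ b
    bounds = back w (subst (c ≤_) (sym at) c≤v) (subst (_≤ d) (sym at) v≤d)
  land : ∀ v → (∃ λ (i : Fin n) → toℕ a ≤ toℕ i × toℕ i ≤ toℕ b × toℕ (σ ⟨$⟩ʳ i) ≡ v) →
         c ≤ v × v ≤ c + (toℕ b ∸ toℕ a)
  land v (i , a≤i , i≤b , refl) rewrite same-length = forth i a≤i i≤b

closed-range-whole : ∀ {n} (σ : Perm n) → IsInvolution σ → IsSimple σ →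
  ∀ {a b} → a < b → b < n → MapsInto σ a b a b → a ≡ 0 × suc b ≡ n
closed-range-whole σ inv simple {a} {b} a<b b<n closed
  with simple a′ b′ a′≤b′ (exchanged-interval σ inv a′ b′ a′≤b′ (toℕ<n b′) closed′ closed′)
  where
  a′ b′ : Fin _
  a′ = fromℕ< (<-trans a<b b<n)
  b′ = fromℕ< b<n
  a′≤b′ : toℕ a′ ≤ toℕ b′
  a′≤b′ = subst₂ _≤_ (sym (toℕ-fromℕ< _)) (sym (toℕ-fromℕ< _)) (<⇒≤ a<b)
  closed′ : MapsInto σ (toℕ a′) (toℕ b′) (toℕ a′) (toℕ b′)
  closed′ = subst₂ (λ a b → MapsInto σ a b a b) (sym (toℕ-fromℕ< _)) (sym (toℕ-fromℕ< _)) closed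
... | inj₁ a′≡b′ = ⊥-elim (<-irrefl (trans (sym (toℕ-fromℕ< _)) (trans (cong toℕ a′≡b′) (toℕ-fromℕ< _))) a<b)
... | inj₂ (a′≡0 , b′≡n) = trans (sym (toℕ-fromℕ< _)) a′≡0 , trans (cong suc (sym (toℕ-fromℕ< _))) b′≡n

-- Around a fixed point p of a 321-avoiding involution, positions left of p have values
-- left of p and positions right of p have values right of p (else p completes a 321).
module FixedPoint {n} (σ : Perm n) (inv : IsInvolution σ) (avoid : Avoids321 σ)
  (p : Fin n) (fixed : σ ⟨$⟩ʳ p ≡ p) where

  σ⟨_⟩ : Fin n → ℕ
  σ⟨ i ⟩ = toℕ (σ ⟨$⟩ʳ i)

  value-p : ∀ j → σ⟨ j ⟩ ≡ toℕ p → toℕ j ≡ toℕ p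
  value-p j e = cong toℕ (trans (sym (inv j)) (trans (cong (σ ⟨$⟩ʳ_) (toℕ-injective e)) fixed))

  σ⟨p⟩ : σ⟨ p ⟩ ≡ toℕ p
  σ⟨p⟩ = cong toℕ fixed

  stays-below : ∀ j → toℕ j < toℕ p → σ⟨ j ⟩ < toℕ p
  stays-below j j<p with <-cmp σ⟨ j ⟩ (toℕ p)
  ... | tri< σj<p _ _ = σj<p
  ... | tri≈ _ σj≡p _ = ⊥-elim (<-irrefl (value-p j σj≡p) j<p)
  ... | tri> _ _ p<σj = ⊥-elim (avoid j p (σ ⟨$⟩ʳ j) j<p p<σj
          (subst₂ _<_ (sym (cong toℕ (inv j))) (sym σ⟨p⟩) j<p , subst (_< σ⟨ j ⟩) (sym σ⟨p⟩) p<σj))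

  stays-above : ∀ j → toℕ p < toℕ j → toℕ p < σ⟨ j ⟩
  stays-above j p<j with <-cmp σ⟨ j ⟩ (toℕ p)
  ... | tri> _ _ p<σj = p<σj
  ... | tri≈ _ σj≡p _ = ⊥-elim (<-irrefl (sym (value-p j σj≡p)) p<j)
  ... | tri< σj<p _ _ = ⊥-elim (avoid (σ ⟨$⟩ʳ j) p j σj<p p<j
          (subst (σ⟨ j ⟩ <_) (sym σ⟨p⟩) σj<p , subst₂ _<_ (sym σ⟨p⟩) (sym (cong toℕ (inv j))) p<j))

  stays-weakly-below : ∀ j → toℕ j ≤ toℕ p → σ⟨ j ⟩ ≤ toℕ p
  stays-weakly-below j j≤p with m≤n⇒m<n∨m≡n j≤p
  ... | inj₁ j<p  = <⇒≤ (stays-below j j<p)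
  ... | inj₂ j≡p  = ≤-reflexive (trans (cong (λ i → σ⟨ i ⟩) (toℕ-injective j≡p)) σ⟨p⟩)

-- A fixed point p would make [1,n-1] (if p = 0), [0,n-2] (if p = n-1) or else [0,p]
-- a proper σ-closed range.
no-fixed-point : ∀ {n} (σ : Perm n) → 2 < n → InI321 σ → IsSimple σ → ∀ p → σ ⟨$⟩ʳ p ≢ p
no-fixed-point {suc (suc (suc k))} σ (s≤s (s≤s (s≤s _))) (inv , avoid) simple p fixed
  with toℕ p ≟ 0 | toℕ p ≟ suc (suc k)
... | yes p≡0 | _ = 1≢0 (proj₁ (closed-range-whole σ inv simple {1} {suc (suc k)} (s≤s (s≤s z≤n)) ≤-refl closed))
  where
  open FixedPoint σ inv avoid p fixed
  1≢0 : 1 ≢ 0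
  1≢0 ()
  closed : MapsInto σ 1 (suc (suc k)) 1 (suc (suc k))
  closed i 1≤i _ = subst (_< σ⟨ i ⟩) p≡0 (stays-above i (subst (_< toℕ i) (sym p≡0) 1≤i))
                 , s≤s⁻¹ (toℕ<n (σ ⟨$⟩ʳ i))
... | no _ | yes p≡last = last≢ (proj₂ (closed-range-whole σ inv simple {0} {suc k} (s≤s z≤n) (m<n⇒m<1+n (n<1+n (suc k))) closed))
  where
  open FixedPoint σ inv avoid p fixed
  last≢ : suc (suc k) ≢ suc (suc (suc k))
  last≢ ()
  closed : MapsInto σ 0 (suc k) 0 (suc k)
  closed i _ i≤k+1 = z≤n , s≤s⁻¹ (subst (σ⟨ i ⟩ <_) p≡last (stays-below i (subst (toℕ i <_) (sym p≡last) (s≤s i≤k+1))))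
... | no p≢0 | no p≢last = p≢last (suc-injective (proj₂ (closed-range-whole σ inv simple (n≢0⇒n>0 p≢0) (toℕ<n p) closed)))
  where
  open FixedPoint σ inv avoid p fixed
  closed : MapsInto σ 0 (toℕ p) 0 (toℕ p)
  closed i _ i≤p = z≤n , stays-weakly-below i i≤p

-- A 321-avoiding involution of length n > 2 does not exchange the first and last positions:
-- otherwise position 1, whose value lies strictly between, completes a 321.
no-corner-swap : ∀ {n} (σ : Perm n) → 2 < n → InI321 σ →
  ∀ (first last : Fin n) → toℕ first ≡ 0 → suc (toℕ last) ≡ n → σ ⟨$⟩ʳ first ≢ last
no-corner-swap {suc (suc (suc k))} σ (s≤s (s≤s (s≤s _))) (inv , avoid) first last first≡0 last≡n swap =
  avoid first one last (subst (_< 1) (sym first≡0) (s≤s z≤n)) (subst (1 <_) (sym last≡k+2) (s≤s (s≤s z≤n)))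
        (subst (_< σ⟨one⟩) (sym σlast≡0) (n≢0⇒n>0 σone≢0) , subst (σ⟨one⟩ <_) (sym σfirst≡k+2) σone<k+2)
  where
  one : Fin (suc (suc (suc k)))
  one = fsuc fzero
  σ⟨one⟩ : ℕ
  σ⟨one⟩ = toℕ (σ ⟨$⟩ʳ one)
  last≡k+2 : toℕ last ≡ suc (suc k)
  last≡k+2 = suc-injective last≡n
  σfirst≡k+2 : toℕ (σ ⟨$⟩ʳ first) ≡ suc (suc k)
  σfirst≡k+2 = trans (cong toℕ swap) last≡k+2
  σlast≡0 : toℕ (σ ⟨$⟩ʳ last) ≡ 0
  σlast≡0 = trans (cong toℕ (involution-swap σ inv swap)) first≡0
  σone≢0 : σ⟨one⟩ ≢ 0
  σone≢0 e with involution-swap σ inv (toℕ-injective (trans e (sym first≡0)))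
  ... | σfirst≡one = 1≢k+2 (trans (cong toℕ (sym σfirst≡one)) σfirst≡k+2)
    where 1≢k+2 : 1 ≢ suc (suc k)
          1≢k+2 ()
  σone≢k+2 : σ⟨one⟩ ≢ suc (suc k)
  σone≢k+2 e with involution-swap σ inv (toℕ-injective (trans e (sym last≡k+2)))
  ... | σlast≡one = 1≢0 (trans (cong toℕ (sym σlast≡one)) σlast≡0)
    where 1≢0 : 1 ≢ 0
          1≢0 ()
  σone<k+2 : σ⟨one⟩ < suc (suc k)
  σone<k+2 = ≤∧≢⇒< (s≤s⁻¹ (toℕ<n (σ ⟨$⟩ʳ one))) σone≢k+2

sumLt-zero : ∀ {k} (f : Fin k → ℕ) → sumLt f 0 ≡ 0
sumLt-zero {zero}  f = refl
sumLt-zero {suc k} f = refl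

sumLt-suc : ∀ {k} (f : Fin k → ℕ) (u : Fin k) → sumLt f (suc (toℕ u)) ≡ sumLt f (toℕ u) + f u
sumLt-suc {suc k} f fzero    = trans (cong (f fzero +_) (sumLt-zero (λ w → f (fsuc w)))) (+-comm (f fzero) 0)
sumLt-suc {suc k} f (fsuc u) = trans (cong (f fzero +_) (sumLt-suc (λ w → f (fsuc w)) u))
                                     (sym (+-assoc (f fzero) _ (f (fsuc u))))

sumLt-mono : ∀ {k} (f : Fin k → ℕ) {i j} → i ≤ j → sumLt f i ≤ sumLt f j
sumLt-mono {zero}  f _ = z≤n
sumLt-mono {suc k} f {zero} _ = z≤n
sumLt-mono {suc k} f {suc i} {suc j} i≤j = +-monoʳ-≤ (f fzero) (sumLt-mono (λ w → f (fsuc w)) (s≤s⁻¹ i≤j))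

sumLt-≤-sumAll : ∀ {k} (f : Fin k → ℕ) j → sumLt f j ≤ sumAll f
sumLt-≤-sumAll {zero}  f j       = z≤n
sumLt-≤-sumAll {suc k} f zero    = z≤n
sumLt-≤-sumAll {suc k} f (suc j) = +-monoʳ-≤ (f fzero) (sumLt-≤-sumAll (λ w → f (fsuc w)) j)

sumLt-cong : ∀ {k} (f g : Fin k → ℕ) j → (∀ u → toℕ u < j → f u ≡ g u) → sumLt f j ≡ sumLt g j
sumLt-cong {zero}  f g j       _  = refl
sumLt-cong {suc k} f g zero    _  = refl
sumLt-cong {suc k} f g (suc j) eq = cong₂ _+_ (eq fzero (s≤s z≤n))
  (sumLt-cong (λ w → f (fsuc w)) (λ w → g (fsuc w)) j (λ u u<j → eq (fsuc u) (s≤s u<j)))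

-- sumAll agrees with the library's sum over a vector, to reuse its permutation invariance.
sumAll≡sum : ∀ {k} (f : Fin k → ℕ) → sumAll f ≡ sum f
sumAll≡sum {zero}  f = refl
sumAll≡sum {suc k} f = cong (f fzero +_) (sumAll≡sum (λ u → f (fsuc u)))

sumAll-permute : ∀ {k} (f : Fin k → ℕ) (σ : Perm k) → sumAll (λ w → f (σ ⟨$⟩ˡ w)) ≡ sumAll f
sumAll-permute f σ = begin
  sumAll (λ w → f (σ ⟨$⟩ˡ w)) ≡⟨ sumAll≡sum (λ w → f (σ ⟨$⟩ˡ w)) ⟩
  sum (λ w → f (σ ⟨$⟩ˡ w))    ≡⟨ sum-permute f (flip σ) ⟨
  sum f                       ≡⟨ sumAll≡sum f ⟨
  sumAll f                    ∎
  where open ≡-Reasoning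

module Blocks {n : ℕ} (x : Fin n → ℕ) where

  start : Fin n → ℕ
  start u = sumLt x (toℕ u)

  InBlock : Fin n → ℕ → Set
  InBlock u p = start u ≤ p × p < start u + x u

  end-mono : ∀ {u v} → toℕ u ≤ toℕ v → start u + x u ≤ start v + x v
  end-mono {u} {v} u≤v = subst₂ _≤_ (sumLt-suc x u) (sumLt-suc x v) (sumLt-mono x (s≤s u≤v))

  end-≤-start : ∀ {u v} → toℕ u < toℕ v → start u + x u ≤ start v
  end-≤-start {u} u<v = subst (_≤ _) (sumLt-suc x u) (sumLt-mono x u<v)

  InBlock-< : ∀ {u p} → InBlock u p → p < sumAll x
  InBlock-< {u} (_ , p<end) = <-≤-trans p<end (subst (_≤ sumAll x) (sumLt-suc x u) (sumLt-≤-sumAll x _))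

  block-mono : ∀ {u v p q} → InBlock u p → InBlock v q → p ≤ q → toℕ u ≤ toℕ v
  block-mono (start≤p , _) (_ , q<end) p≤q =
    ≮⇒≥ λ v<u → <⇒≱ q<end (≤-trans (end-≤-start v<u) (≤-trans start≤p p≤q))

  block-unique : ∀ {u v p} → InBlock u p → InBlock v p → u ≡ v
  block-unique p∈u p∈v = toℕ-injective (≤-antisym (block-mono p∈u p∈v ≤-refl) (block-mono p∈v p∈u ≤-refl))

  later-block : ∀ {u v p} → InBlock v p → start u + x u ≤ p → toℕ u < toℕ v
  later-block (_ , p<end) end≤p = ≰⇒> λ v≤u → <⇒≱ p<end (≤-trans (end-mono v≤u) end≤p)

  module Nonempty (x-pos : ∀ u → 1 ≤ x u) where

    last : Fin n → ℕ
    last u = start u + pred (x u)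

    last-< : ∀ u → last u < start u + x u
    last-< u = +-monoʳ-< (start u) (pred< (x-pos u))
      where
      pred< : ∀ {c} → 1 ≤ c → pred c < c
      pred< {suc c} _ = n<1+n c

    from-range : ∀ {u p} → start u ≤ p → p ≤ last u → InBlock u p
    from-range {u} start≤p p≤last = start≤p , ≤-<-trans p≤last (last-< u)

    to-range : ∀ {u p} → InBlock u p → p ≤ last u
    to-range {u} (_ , p<end) = <+⇒≤+pred (x-pos u) p<end
      where
      <+⇒≤+pred : ∀ {p s c} → 1 ≤ c → p < s + c → p ≤ s + pred c
      <+⇒≤+pred {p} {s} {suc c} _ p<s+c = s≤s⁻¹ (subst (p <_) (+-suc s c) p<s+c)

    start∈block : ∀ u → InBlock u (start u)
    start∈block u = from-range ≤-refl (m≤m+n (start u) _)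

    last∈block : ∀ u → InBlock u (last u)
    last∈block u = from-range (m≤m+n (start u) _) ≤-refl

    meet : ∀ {lo hi a z} → InBlock lo a → InBlock hi z → a ≤ z →
           ∀ u → toℕ lo ≤ toℕ u → toℕ u ≤ toℕ hi → ∃ λ p → a ≤ p × p ≤ z × InBlock u p
    meet {lo} {hi} {a} {z} a∈lo z∈hi a≤z u lo≤u u≤hi with m≤n⇒m<n∨m≡n lo≤u
    ... | inj₂ lo≡u = a , ≤-refl , a≤z , subst (λ w → InBlock w a) (toℕ-injective lo≡u) a∈lo
    ... | inj₁ lo<u = start u , <⇒≤ (<-≤-trans (proj₂ a∈lo) (end-≤-start lo<u))
                    , ≤-trans (sumLt-mono x u≤hi) (proj₁ z∈hi) , start∈block u

locate : ∀ {n} (x : Fin n → ℕ) p → p < sumAll x → ∃ λ u → Blocks.InBlock x u p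
locate {suc n} x p p<total with p <? x fzero
... | yes p<x₀ = fzero , z≤n , p<x₀
... | no  p≮x₀ with m≤n⇒∃[o]m+o≡n (≮⇒≥ p≮x₀)
... | q , refl with locate (λ u → x (fsuc u)) q (+-cancelˡ-< (x fzero) q _ p<total)
... | u , start≤q , q<end = fsuc u , +-monoʳ-≤ (x fzero) start≤q
                          , subst (x fzero + q <_) (sym (+-assoc (x fzero) _ (x (fsuc u)))) (+-monoʳ-< (x fzero) q<end)

-- If F sends each A-block u into the B-block σ u, and sends the positions [a,z] into [a′,z′],
-- then σ sends the A-blocks from the one of a to the one of z into the B-blocks from the one
-- of a′ to the one of z′ (each A-block in between meets [a,z]).
block-range : ∀ {n} (σ : Perm n) (F : ℕ → ℕ) (A B : Fin n → ℕ) → (∀ u → 1 ≤ A u) →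
  (∀ u p → Blocks.InBlock A u p → Blocks.InBlock B (σ ⟨$⟩ʳ u) (F p)) →
  ∀ {lo hi lo′ hi′ a z a′ z′} →
  Blocks.InBlock A lo a → Blocks.InBlock A hi z → a ≤ z →
  Blocks.InBlock B lo′ a′ → Blocks.InBlock B hi′ z′ →
  (∀ p → a ≤ p → p ≤ z → a′ ≤ F p × F p ≤ z′) →
  MapsInto σ (toℕ lo) (toℕ hi) (toℕ lo′) (toℕ hi′)
block-range σ F A B A-pos A→B a∈lo z∈hi a≤z a′∈lo′ z′∈hi′ range u lo≤u u≤hi
  with Blocks.Nonempty.meet A A-pos a∈lo z∈hi a≤z u lo≤u u≤hi
... | p , a≤p , p≤z , p∈u =
  block-mono a′∈lo′ Fp∈σu (proj₁ (range p a≤p p≤z)) , block-mono Fp∈σu z′∈hi′ (proj₂ (range p a≤p p≤z))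
  where
  open Blocks B using (block-mono)
  Fp∈σu : Blocks.InBlock B (σ ⟨$⟩ʳ u) (F p)
  Fp∈σu = A→B u p p∈u

module Correspondence {n : ℕ} (σ : Perm n) (2<n : 2 < n) (σ-I321 : InI321 σ) (simple : IsSimple σ)
  (F : ℕ → ℕ) (x y : Fin n → ℕ) (x-pos : ∀ u → 1 ≤ x u) (y-pos : ∀ u → 1 ≤ y u)
  (same-total : sumAll y ≡ sumAll x)
  (x→y : ∀ u p → Blocks.InBlock x u p → Blocks.InBlock y (σ ⟨$⟩ʳ u) (F p))
  (y→x : ∀ w p → Blocks.InBlock y w p → Blocks.InBlock x (σ ⟨$⟩ʳ w) (F p)) where

  module X = Blocks x
  module Y = Blocks y
  module X⁺ = X.Nonempty x-pos
  module Y⁺ = Y.Nonempty y-pos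

  inv : IsInvolution σ
  inv = proj₁ σ-I321

  locate-y : ∀ p → p < sumAll x → ∃ λ w → Y.InBlock w p
  locate-y p p<N = locate y p (subst (p <_) (sym same-total) p<N)

  -- Suppose block r starts at s₀ in both tilings but x r < y r.  Let Y_r = [s₀,e] and let hi be
  -- the x-block of e, so r < hi.  F exchanges Y_r with X_{σ r} = [t₀,t₁], so by block-range σ
  -- exchanges the x-blocks [r,hi] with the y-blocks [lo′,hi′] of t₀ and t₁: [r,hi] is a
  -- nontrivial interval of σ, hence r = 0 and hi = n-1.  But then σ r = hi, a corner swap.
  module Mismatch (r : Fin n) (same-start : X.start r ≡ Y.start r) (shorter : x r < y r) where

    s₀ e t₀ t₁ : ℕ
    s₀ = Y.start r
    e  = Y⁺.last r
    t₀ = X.start (σ ⟨$⟩ʳ r)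
    t₁ = X⁺.last (σ ⟨$⟩ʳ r)

    s₀∈r : X.InBlock r s₀
    s₀∈r = subst (X.InBlock r) same-start (X⁺.start∈block r)

    e<N : e < sumAll x
    e<N = subst (e <_) same-total (Y.InBlock-< (Y⁺.last∈block r))

    hi : Fin n
    hi = proj₁ (locate x e e<N)

    e∈hi : X.InBlock hi e
    e∈hi = proj₂ (locate x e e<N)

    r<hi : toℕ r < toℕ hi
    r<hi = X.later-block e∈hi (subst (λ s → s + x r ≤ e) (sym same-start) (+-monoʳ-≤ s₀ (<⇒≤pred shorter)))

    lo′ hi′ : Fin n
    lo′ = proj₁ (locate-y t₀ (X.InBlock-< (X⁺.start∈block (σ ⟨$⟩ʳ r))))
    hi′ = proj₁ (locate-y t₁ (X.InBlock-< (X⁺.last∈block (σ ⟨$⟩ʳ r))))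

    t₀∈lo′ : Y.InBlock lo′ t₀
    t₀∈lo′ = proj₂ (locate-y t₀ (X.InBlock-< (X⁺.start∈block (σ ⟨$⟩ʳ r))))

    t₁∈hi′ : Y.InBlock hi′ t₁
    t₁∈hi′ = proj₂ (locate-y t₁ (X.InBlock-< (X⁺.last∈block (σ ⟨$⟩ʳ r))))

    forth : MapsInto σ (toℕ r) (toℕ hi) (toℕ lo′) (toℕ hi′)
    forth = block-range σ F x y x-pos x→y s₀∈r e∈hi (m≤m+n s₀ _) t₀∈lo′ t₁∈hi′ Yr→Xσr
      where
      Yr→Xσr : ∀ p → s₀ ≤ p → p ≤ e → t₀ ≤ F p × F p ≤ t₁
      Yr→Xσr p s₀≤p p≤e = proj₁ Fp∈σr , X⁺.to-range Fp∈σr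
        where
        Fp∈σr : X.InBlock (σ ⟨$⟩ʳ r) (F p)
        Fp∈σr = y→x r p (Y⁺.from-range s₀≤p p≤e)

    back : MapsInto σ (toℕ lo′) (toℕ hi′) (toℕ r) (toℕ hi)
    back = block-range σ F y x y-pos y→x t₀∈lo′ t₁∈hi′ (m≤m+n t₀ _) s₀∈r e∈hi Xσr→Yr
      where
      Xσr→Yr : ∀ p → t₀ ≤ p → p ≤ t₁ → s₀ ≤ F p × F p ≤ e
      Xσr→Yr p t₀≤p p≤t₁ = proj₁ Fp∈r , Y⁺.to-range Fp∈r
        where
        Fp∈r : Y.InBlock r (F p)
        Fp∈r = subst (λ w → Y.InBlock w (F p)) (inv r) (x→y (σ ⟨$⟩ʳ r) p (X⁺.from-range t₀≤p p≤t₁))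

    whole : toℕ r ≡ 0 × suc (toℕ hi) ≡ n
    whole with simple r hi (<⇒≤ r<hi) (exchanged-interval σ inv r hi (<⇒≤ r<hi) (toℕ<n hi′) forth back)
    ... | inj₁ r≡hi = ⊥-elim (<-irrefl (cong toℕ r≡hi) r<hi)
    ... | inj₂ ends = ends

    -- F s₀ lies in X_{σ r} and in Y_{σ r}, which comes after Y_r ∋ e since r = 0 is not fixed.
    σr≡hi : σ ⟨$⟩ʳ r ≡ hi
    σr≡hi = toℕ-injective (≤-antisym (s≤s⁻¹ (subst (toℕ (σ ⟨$⟩ʳ r) <_) (sym (proj₂ whole)) (toℕ<n _))) hi≤σr)
      where
      r<σr : toℕ r < toℕ (σ ⟨$⟩ʳ r)
      r<σr = subst (_< toℕ (σ ⟨$⟩ʳ r)) (sym (proj₁ whole)) (n≢0⇒n>0 λ σr≡0 →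
               no-fixed-point σ 2<n σ-I321 simple r (toℕ-injective (trans σr≡0 (sym (proj₁ whole)))))
      e<Fs₀ : e < F s₀
      e<Fs₀ = <-≤-trans (Y⁺.last-< r) (≤-trans (Y.end-≤-start r<σr) (proj₁ (x→y r s₀ s₀∈r)))
      hi≤σr : toℕ hi ≤ toℕ (σ ⟨$⟩ʳ r)
      hi≤σr = X.block-mono e∈hi (y→x r s₀ (Y⁺.start∈block r)) (<⇒≤ e<Fs₀)

    absurd : ⊥
    absurd = no-corner-swap σ 2<n σ-I321 r hi (proj₁ whole) (proj₂ whole) σr≡hi

  not-shorter : ∀ r → X.start r ≡ Y.start r → ¬ x r < y r
  not-shorter r same-start shorter = Mismatch.absurd r same-start shorter

-- For π = σ[α₁,…,αₙ] an involution, the position blocks (sizes m) and the value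
-- blocks (sizes m′ = m ∘ σ⁻¹) tile [0,N) and π exchanges them according to σ.  Comparing block
-- sizes from left to right, Correspondence.not-shorter forces m = m′; so position block u and
-- value block u coincide, a fixed point of π would give a fixed point of σ, and N is even.
module InflatedInvolution {n : ℕ} (σ : Perm n) (2<n : 2 < n) (σ-I321 : InI321 σ) (simple : IsSimple σ)
  (m : Fin n → ℕ) (α : (i : Fin n) → Perm (m i)) (π : Perm (sumAll m))
  (m-pos : ∀ i → 1 ≤ m i) (inflation : IsInflation σ m α π) (π-inv : IsInvolution π) where

  N : ℕ
  N = sumAll m

  -- size of the u-th block of values
  m′ : Fin n → ℕ
  m′ w = m (σ ⟨$⟩ˡ w)

  module P = Blocks m
  module V = Blocks m′

  F : ℕ → ℕ
  F = extend (π ⟨$⟩ʳ_)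

  positions→values-Fin : ∀ u (p : Fin N) → P.InBlock u (toℕ p) → V.InBlock (σ ⟨$⟩ʳ u) (toℕ (π ⟨$⟩ʳ p))
  positions→values-Fin u p (start≤p , p<end) with m≤n⇒∃[o]m+o≡n start≤p
  ... | q , p≡start+q = subst (V.InBlock (σ ⟨$⟩ʳ u)) (sym value)
        (m≤m+n _ _ , +-monoʳ-< (V.start (σ ⟨$⟩ʳ u)) (subst (toℕ (α u ⟨$⟩ʳ j) <_) (sym size) (toℕ<n _)))
    where
    q<m : q < m u
    q<m = +-cancelˡ-< (P.start u) q (m u) (subst (_< P.start u + m u) (sym p≡start+q) p<end)
    j : Fin (m u)
    j = fromℕ< q<m
    value : toℕ (π ⟨$⟩ʳ p) ≡ V.start (σ ⟨$⟩ʳ u) + toℕ (α u ⟨$⟩ʳ j)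
    value = inflation u j p (trans (sym p≡start+q) (cong (P.start u +_) (sym (toℕ-fromℕ< q<m))))
    size : m′ (σ ⟨$⟩ʳ u) ≡ m u
    size = cong m (inverseˡ σ)

  positions→values : ∀ u p → P.InBlock u p → V.InBlock (σ ⟨$⟩ʳ u) (F p)
  positions→values u p p∈u = below-from-Fin (λ p → P.InBlock u p → V.InBlock (σ ⟨$⟩ʳ u) (F p))
    (λ p p∈u → subst (V.InBlock (σ ⟨$⟩ʳ u)) (sym (extend-toℕ (π ⟨$⟩ʳ_) p)) (positions→values-Fin u p p∈u))
    p (P.InBlock-< p∈u) p∈u

  same-total : sumAll m′ ≡ sumAll m
  same-total = sumAll-permute m σ

  -- since π is an involution, it also sends value block w back into position block σ w
  values→positions : ∀ w p → V.InBlock w p → P.InBlock (σ ⟨$⟩ʳ w) (F p)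
  values→positions w p p∈w = subst (λ v → P.InBlock v (F p)) i≡σw Fp∈i
    where
    p<N : p < N
    p<N = subst (p <_) same-total (V.InBlock-< p∈w)
    i : Fin n
    i = proj₁ (locate m (F p) (extend-< (π ⟨$⟩ʳ_) p p<N))
    Fp∈i : P.InBlock i (F p)
    Fp∈i = proj₂ (locate m (F p) (extend-< (π ⟨$⟩ʳ_) p p<N))
    p∈σi : V.InBlock (σ ⟨$⟩ʳ i) p
    p∈σi = subst (V.InBlock (σ ⟨$⟩ʳ i)) (extend-involutive (π ⟨$⟩ʳ_) π-inv p p<N) (positions→values i (F p) Fp∈i)
    i≡σw : i ≡ σ ⟨$⟩ʳ w
    i≡σw = trans (sym (proj₁ σ-I321 i)) (cong (σ ⟨$⟩ʳ_) (V.block-unique p∈σi p∈w))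

  module PV = Correspondence σ 2<n σ-I321 simple F m m′ m-pos (λ w → m-pos (σ ⟨$⟩ˡ w))
                same-total positions→values values→positions
  module VP = Correspondence σ 2<n σ-I321 simple F m′ m (λ w → m-pos (σ ⟨$⟩ˡ w)) m-pos
                (sym same-total) values→positions positions→values

  same-start⇒same-size : ∀ u → P.start u ≡ V.start u → m u ≡ m′ u
  same-start⇒same-size u same-start with <-cmp (m u) (m′ u)
  ... | tri< m<m′ _ _ = ⊥-elim (PV.not-shorter u same-start m<m′)
  ... | tri≈ _ m≡m′ _ = m≡m′
  ... | tri> _ _ m′<m = ⊥-elim (VP.not-shorter u (sym same-start) m′<m)

  sizes-agree-below : ∀ k u → toℕ u < k → m u ≡ m′ u
  sizes-agree-below (suc k) u u<k+1 with m≤n⇒m<n∨m≡n (s≤s⁻¹ u<k+1)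
  ... | inj₁ u<k = sizes-agree-below k u u<k
  ... | inj₂ u≡k = same-start⇒same-size u
        (sumLt-cong m m′ (toℕ u) (λ v v<u → sizes-agree-below k v (subst (toℕ v <_) u≡k v<u)))

  same-blocks : ∀ w p → V.InBlock w p → P.InBlock w p
  same-blocks w p = subst₂ (λ s l → s ≤ p × p < s + l) (sym same-start) (sym (size w))
    where
    size : ∀ u → m u ≡ m′ u
    size u = sizes-agree-below (suc (toℕ u)) u (n<1+n (toℕ u))
    same-start : P.start w ≡ V.start w
    same-start = sumLt-cong m m′ (toℕ w) (λ u _ → size u)

  no-fixed : ∀ p → π ⟨$⟩ʳ p ≢ p
  no-fixed p fixed with locate m (toℕ p) (toℕ<n p)
  ... | u , p∈u = no-fixed-point σ 2<n σ-I321 simple u (sym (P.block-unique p∈u p∈σu))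
    where
    p∈σu : P.InBlock (σ ⟨$⟩ʳ u) (toℕ p)
    p∈σu = same-blocks (σ ⟨$⟩ʳ u) (toℕ p) (subst (V.InBlock (σ ⟨$⟩ʳ u)) (cong toℕ fixed) (positions→values-Fin u p p∈u))

  even : 2 ∣ N
  even = involution-even (π ⟨$⟩ʳ_) π-inv no-fixed

proposition2p4 : (∀ (n : ℕ) (σ : Perm n) → 2 < n → InI321 σ → IsSimple σ → 2 ∣ n)
    × (∀ (n : ℕ) (σ : Perm n) → 2 < n → InI321 σ → IsSimple σ →
    ∀ (m : Fin n → ℕ) (α : (i : Fin n) → Perm (m i)) (π : Perm (sumAll m)) →
    (∀ i → 1 ≤ m i) → IsInflation σ m α π → IsInvolution π → 2 ∣ sumAll m)
proposition2p4 =
  (λ n σ 2<n σ-I321 simple →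
     involution-even (σ ⟨$⟩ʳ_) (proj₁ σ-I321) (no-fixed-point σ 2<n σ-I321 simple))
  , (λ n σ 2<n σ-I321 simple m α π m-pos inflation π-inv →
     InflatedInvolution.even σ 2<n σ-I321 simple m α π m-pos inflation π-inv)
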